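{- The following rules are admissible in $\mathbf{C}_4$ (whenever their premises are derivable in $\mathbf{C}_4$, so is their conclusion): (IO-Wk) from $G\vdash(B,Y)$ infer $(A,X),G\vdash(B,Y)$; (IO-Ctr) from $(A,X),(A,X),G\vdash(B,Y)$ infer $(A,X),G\vdash(B,Y)$; (IO-Cut) from $G\vdash(C,Z)$ and $(C,Z),G'\vdash(B,Y)$ infer $G,G'\vdash(B,Y)$.
   Context: Formulas are classical propositional formulas; $\models$ is classical entailment. An LK sequent $\Gamma\Rightarrow\Delta$ is derivable in LK iff $\bigwedge\Gamma\models\bigvee\Delta$ (empty conjunction $=\top$, empty disjunction $=\bot$). An I/O pair is an ordered pair $(A,X)$ of formulas; an I/O sequent has the form $G\vdash(B,Y)$ with $G$ a finite multiset of pairs ($G,G'$ denotes multiset union). The calculus $\mathbf{C}_4$ has the rules: (IN) from $B\Rightarrow$ infer $G\vdash(B,Y)$; (OUT) from $\Rightarrow Y$ infer $G\vdash(B,Y)$; (E4) from $G\vdash(B\wedge\neg A,Y)$ and $G\vdash(B\wedge X,Y\vee\neg X)$ infer $(A,X),G\vdash(B,Y)$. An I/O sequent is derivable in $\mathbf{C}_4$ if it is the root of a finite tree built with these rules in which every LK-sequent premise is derivable in LK. -}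

module Defs where

open import Data.Nat using (ℕ)
open import Data.Bool using (Bool; true; false; _∧_; _∨_; not)
open import Data.List using (List; []; _∷_; _++_; foldr)
open import Data.Product using (_×_; _,_)
open import Relation.Binary.PropositionalEquality using (_≡_)
open import Data.List.Relation.Binary.Permutation.Propositional using (_↭_)

data Formula : Set where
  atom : ℕ → Formula
  ⊤′ ⊥′ : Formula
  ¬′_ : Formula → Formula
  _∧′_ _∨′_ _⇒′_ : Formula → Formula → Formula

infixr 6 _∧′_
infixr 5 _∨′_
infixr 4 _⇒′_
infix 7 ¬′_

Valuation : Set
Valuation = ℕ → Bool

⟦_⟧ : Formula → Valuation → Bool
⟦ atom p ⟧ v = v p
⟦ ⊤′ ⟧ v = true
⟦ ⊥′ ⟧ v = false
⟦ ¬′ A ⟧ v = not (⟦ A ⟧ v)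
⟦ A ∧′ B ⟧ v = ⟦ A ⟧ v ∧ ⟦ B ⟧ v
⟦ A ∨′ B ⟧ v = ⟦ A ⟧ v ∨ ⟦ B ⟧ v
⟦ A ⇒′ B ⟧ v = not (⟦ A ⟧ v) ∨ ⟦ B ⟧ v

_⊨_ : Formula → Formula → Set
A ⊨ B = ∀ (v : Valuation) → ⟦ A ⟧ v ≡ true → ⟦ B ⟧ v ≡ true

⋀ ⋁ : List Formula → Formula
⋀ = foldr _∧′_ ⊤′
⋁ = foldr _∨′_ ⊥′

-- An LK sequent Γ ⇒ Δ is derivable in LK iff ⋀Γ ⊨ ⋁Δ (as stated in the context).
LK⊢ : List Formula → List Formula → Set
LK⊢ Γ Δ = ⋀ Γ ⊨ ⋁ Δ

Pair : Set
Pair = Formula × Formula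

-- Finite multisets of pairs are represented as lists; the rules are made
-- insensitive to order via permutation (_↭_) in the rule E4.
infix 3 _⊢C4_
data _⊢C4_ : List Pair → Pair → Set where
  IN  : ∀ {G B Y} → LK⊢ (B ∷ []) [] → G ⊢C4 (B , Y)
  OUT : ∀ {G B Y} → LK⊢ [] (Y ∷ []) → G ⊢C4 (B , Y)
  E4  : ∀ {G G′ A X B Y} → G ↭ ((A , X) ∷ G′) →
        G′ ⊢C4 (B ∧′ ¬′ A , Y) →
        G′ ⊢C4 (B ∧′ X , Y ∨′ ¬′ X) →
        G ⊢C4 (B , Y)

module Submission where

-- E4 is invertible and indifferent to the order in which pairs are processed,
-- and derivability is monotone: a derivation of G ⊢ (B , Y) yields one of
-- G ⊢ (B′ , Y′) whenever B′ ⊨ B and Y ⊨ Y′.  Weakening is then immediate, and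
-- contraction follows by inverting both copies of the pair, since the
-- conjuncts and disjuncts they contribute are duplicates.  Cut is by induction
-- on the derivation of G ⊢ (C , Z): at an IN or OUT leaf the pair (C , Z) is
-- inert and is removed by inversion; at an E4 step on (A , X) the pair
-- (C , Z) in the right premise is traded for the pairs (C ∧ ¬A , Z) and
-- (C ∧ X , Z ∨ ¬X) of the E4 premises, and the cut moves up.

open import Defs
open import Data.Bool using (true; false; _∧_; _∨_; not)
open import Data.Bool.Properties using (∧-conicalˡ; ∨-zeroʳ)
open import Data.List using (List; []; _∷_; _++_)
open import Data.List.Membership.Propositional.Properties using (∈-∃++)
open import Data.List.Relation.Binary.Permutation.Propositional
  using (_↭_; prep; swap; trans; ↭-sym; ↭-refl)
open import Data.List.Relation.Binary.Permutation.Propositional.Properties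
  using (drop-∷; ∈-resp-↭; shift; ++⁺ʳ)
open import Data.List.Relation.Unary.Any using (here; there)
open import Data.Product using (_×_; _,_; ∃; proj₁; proj₂)
open import Data.Sum using (_⊎_; inj₁; inj₂)
open import Function using (id; _∘_)
open import Relation.Binary.PropositionalEquality using (_≡_; refl; cong; cong₂)

private
  variable
    A X B Y B′ Y′ C Z C′ Z′ : Formula
    G G′ H : List Pair
    p : Pair

-- Entailment is wrapped in a record so that its formulas are recoverable by
-- unification, which fails for the raw function type _⊨_.
infix 2 _⊫_
record _⊫_ (P Q : Formula) : Set where
  field at : P ⊨ Q
open _⊫_

⊫-refl : A ⊫ A
⊫-refl .at v = id

unsatisfiable : LK⊢ (C ∷ []) [] → ∀ v → ⟦ C ⟧ v ≡ false
unsatisfiable {C} ⊢C v with ⟦ C ⟧ v | ⊢C v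
... | false | _ = refl
... | true | refute with refute refl
...   | ()

valid : LK⊢ [] (Z ∷ []) → ∀ v → ⟦ Z ⟧ v ≡ true
valid {Z} ⊢Z v with ⟦ Z ⟧ v | ⊢Z v refl
... | true | _ = refl
... | false | ()

∧-monoˡ-⊫ : B′ ⊫ B → B′ ∧′ C ⊫ B ∧′ C
∧-monoˡ-⊫ {B′} {B} {C} h .at v with ⟦ B′ ⟧ v in b′ | ⟦ C ⟧ v
... | true | _ = cong₂ _∧_ (at h v b′)
... | false | _ = λ ()

∨-monoˡ-⊫ : Y ⊫ Y′ → Y ∨′ Z ⊫ Y′ ∨′ Z
∨-monoˡ-⊫ {Y} {Y′} {Z} h .at v with ⟦ Y ⟧ v in y | ⟦ Z ⟧ v
... | true | z = λ _ → cong (_∨ z) (at h v y)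
... | false | true = λ _ → ∨-zeroʳ (⟦ Y′ ⟧ v)
... | false | false = λ ()

∧-elimˡ-⊫ : ∀ B C → B ∧′ C ⊫ B
∧-elimˡ-⊫ B C .at v = ∧-conicalˡ (⟦ B ⟧ v) (⟦ C ⟧ v)

∨-introˡ-⊫ : ∀ Y Z → Y ⊫ Y ∨′ Z
∨-introˡ-⊫ Y Z .at v = cong (_∨ ⟦ Z ⟧ v)

∧-swapʳ-⊫ : ∀ B C D → (B ∧′ C) ∧′ D ⊫ (B ∧′ D) ∧′ C
∧-swapʳ-⊫ B C D .at v with ⟦ B ⟧ v | ⟦ C ⟧ v | ⟦ D ⟧ v
... | true | true | true = id
... | true | true | false = λ ()
... | true | false | _ = λ ()
... | false | _ | _ = λ ()

∨-swapʳ-⊫ : ∀ Y Z W → (Y ∨′ Z) ∨′ W ⊫ (Y ∨′ W) ∨′ Z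
∨-swapʳ-⊫ Y Z W .at v with ⟦ Y ⟧ v | ⟦ Z ⟧ v | ⟦ W ⟧ v
... | true | _ | _ = id
... | false | true | true = id
... | false | true | false = id
... | false | false | true = id
... | false | false | false = λ ()

∧-dupʳ-⊫ : ∀ B C → B ∧′ C ⊫ (B ∧′ C) ∧′ C
∧-dupʳ-⊫ B C .at v with ⟦ B ⟧ v | ⟦ C ⟧ v
... | true | true = id
... | true | false = λ ()
... | false | _ = λ ()

∨-dupʳ-⊫ : ∀ Y Z → (Y ∨′ Z) ∨′ Z ⊫ Y ∨′ Z
∨-dupʳ-⊫ Y Z .at v with ⟦ Y ⟧ v | ⟦ Z ⟧ v
... | true | _ = id
... | false | true = id
... | false | false = λ ()

∧-elimᵐ-⊫ : ∀ B K Z → (B ∧′ K) ∧′ Z ⊫ B ∧′ Z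
∧-elimᵐ-⊫ B K Z .at v with ⟦ B ⟧ v | ⟦ K ⟧ v
... | true | true = id
... | true | false = λ ()
... | false | _ = λ ()

∧-¬-cancelʳ-⊫ : ∀ B K C → (B ∧′ K) ∧′ ¬′ (C ∧′ K) ⊫ B ∧′ ¬′ C
∧-¬-cancelʳ-⊫ B K C .at v with ⟦ B ⟧ v | ⟦ K ⟧ v | ⟦ C ⟧ v
... | true | true | false = id
... | true | true | true = λ ()
... | true | false | _ = λ ()
... | false | _ | _ = λ ()

disjunctive-syllogism-⊫ : ∀ B X Z → (B ∧′ X) ∧′ (Z ∨′ ¬′ X) ⊫ B ∧′ Z
disjunctive-syllogism-⊫ B X Z .at v with ⟦ B ⟧ v | ⟦ X ⟧ v | ⟦ Z ⟧ v
... | true | true | true = id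
... | true | true | false = λ ()
... | true | false | _ = λ ()
... | false | _ | _ = λ ()

∨-¬-absorbʳ-⊫ : ∀ Y Z X → Y ∨′ ¬′ Z ⊫ (Y ∨′ ¬′ X) ∨′ ¬′ (Z ∨′ ¬′ X)
∨-¬-absorbʳ-⊫ Y Z X .at v with ⟦ Y ⟧ v | ⟦ Z ⟧ v | ⟦ X ⟧ v
... | true | _ | _ = id
... | false | false | true = id
... | false | false | false = id
... | false | true | _ = λ ()

∧-¬-unsatisfiable-⊫ : LK⊢ (C ∷ []) [] → B ⊫ B ∧′ ¬′ C
∧-¬-unsatisfiable-⊫ {C = C} ⊢C .at v e = cong₂ _∧_ e (cong not (unsatisfiable {C} ⊢C v))

∧-valid-⊫ : LK⊢ [] (Z ∷ []) → B ⊫ B ∧′ Z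
∧-valid-⊫ {Z = Z} ⊢Z .at v e = cong₂ _∧_ e (valid {Z} ⊢Z v)

∨-¬-valid-⊫ : LK⊢ [] (Z ∷ []) → Y ∨′ ¬′ Z ⊫ Y
∨-¬-valid-⊫ {Z = Z} {Y = Y} ⊢Z .at v with ⟦ Y ⟧ v | ⟦ Z ⟧ v | valid {Z} ⊢Z v
... | true | _ | _ = id
... | false | .true | refl = λ ()

⊢-resp-↭ : G ↭ H → G ⊢C4 p → H ⊢C4 p
⊢-resp-↭ σ (IN ⊢B) = IN ⊢B
⊢-resp-↭ σ (OUT ⊢Y) = OUT ⊢Y
⊢-resp-↭ σ (E4 τ d₁ d₂) = E4 (trans (↭-sym σ) τ) d₁ d₂

⊢-mono : B′ ⊫ B → Y ⊫ Y′ → G ⊢C4 (B , Y) → G ⊢C4 (B′ , Y′)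
⊢-mono B′⊫B Y⊫Y′ (IN ⊢B) = IN λ v → ⊢B v ∘ at (∧-monoˡ-⊫ {C = ⊤′} B′⊫B) v
⊢-mono B′⊫B Y⊫Y′ (OUT ⊢Y) = OUT λ v → at (∨-monoˡ-⊫ {Z = ⊥′} Y⊫Y′) v ∘ ⊢Y v
⊢-mono B′⊫B Y⊫Y′ (E4 σ d₁ d₂) =
  E4 σ (⊢-mono (∧-monoˡ-⊫ B′⊫B) Y⊫Y′ d₁)
       (⊢-mono (∧-monoˡ-⊫ B′⊫B) (∨-monoˡ-⊫ Y⊫Y′) d₂)

⊢-weaken : G ⊢C4 p → ((A , X) ∷ G) ⊢C4 p
⊢-weaken (IN ⊢B) = IN ⊢B
⊢-weaken (OUT ⊢Y) = OUT ⊢Y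
⊢-weaken (E4 σ d₁ d₂) = E4 (trans (prep _ σ) (swap _ _ ↭-refl)) (⊢-weaken d₁) (⊢-weaken d₂)

⊢-weaken-++ : ∀ H → G ⊢C4 p → (H ++ G) ⊢C4 p
⊢-weaken-++ [] d = d
⊢-weaken-++ (_ ∷ H) d = ⊢-weaken (⊢-weaken-++ H d)

↭-∷-cases : ∀ {a b : Pair} {G H} → (a ∷ G) ↭ (b ∷ H) →
            (a ≡ b × G ↭ H) ⊎ ∃ λ K → G ↭ (b ∷ K) × H ↭ (a ∷ K)
↭-∷-cases {a} {b} σ with ∈-resp-↭ σ (here refl)
... | here refl = inj₁ (refl , drop-∷ σ)
... | there a∈H with ∈-∃++ a∈H
...   | xs , ys , refl =
  inj₂ (xs ++ ys , drop-∷ (trans σ (trans (prep b (shift a xs ys)) (swap _ _ ↭-refl)))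
                 , shift a xs ys)

⊢-invert-↭ : H ↭ ((A , X) ∷ G) → H ⊢C4 (B , Y) →
             G ⊢C4 (B ∧′ ¬′ A , Y) × G ⊢C4 (B ∧′ X , Y ∨′ ¬′ X)
⊢-invert-↭ {A = A} {X} {B = B} _ (IN ⊢B) =
  ⊢-mono (∧-elimˡ-⊫ B (¬′ A)) ⊫-refl (IN ⊢B) , ⊢-mono (∧-elimˡ-⊫ B X) ⊫-refl (IN ⊢B)
⊢-invert-↭ {X = X} {Y = Y} _ (OUT ⊢Y) =
  OUT ⊢Y , ⊢-mono ⊫-refl (∨-introˡ-⊫ Y (¬′ X)) (OUT ⊢Y)
⊢-invert-↭ {A = A} {X} {B = B} {Y} σ (E4 {A = A′} {X = X′} τ d₁ d₂)
  with ↭-∷-cases (trans (↭-sym σ) τ)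
... | inj₁ (refl , ρ) = ⊢-resp-↭ (↭-sym ρ) d₁ , ⊢-resp-↭ (↭-sym ρ) d₂
... | inj₂ (K , ρ , ρ′)
  with ⊢-invert-↭ ρ′ d₁ | ⊢-invert-↭ ρ′ d₂
... | e₁₁ , e₁₂ | e₂₁ , e₂₂ =
  E4 ρ (⊢-mono (∧-swapʳ-⊫ B (¬′ A) (¬′ A′)) ⊫-refl e₁₁)
       (⊢-mono (∧-swapʳ-⊫ B (¬′ A) X′) ⊫-refl e₂₁) ,
  E4 ρ (⊢-mono (∧-swapʳ-⊫ B X (¬′ A′)) ⊫-refl e₁₂)
       (⊢-mono (∧-swapʳ-⊫ B X X′) (∨-swapʳ-⊫ Y (¬′ X′) (¬′ X)) e₂₂)

⊢-invert : ((A , X) ∷ G) ⊢C4 (B , Y) →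
           G ⊢C4 (B ∧′ ¬′ A , Y) × G ⊢C4 (B ∧′ X , Y ∨′ ¬′ X)
⊢-invert = ⊢-invert-↭ ↭-refl

⊢-contract : ((A , X) ∷ (A , X) ∷ G) ⊢C4 (B , Y) → ((A , X) ∷ G) ⊢C4 (B , Y)
⊢-contract {A} {X} {B = B} {Y} d =
  E4 ↭-refl (⊢-mono (∧-dupʳ-⊫ B (¬′ A)) ⊫-refl (proj₁ (⊢-invert (proj₁ (⊢-invert d)))))
            (⊢-mono (∧-dupʳ-⊫ B X) (∨-dupʳ-⊫ Y (¬′ X)) (proj₂ (⊢-invert (proj₂ (⊢-invert d)))))

⊢-replace-pair : B′ ∧′ ¬′ C′ ⊫ B ∧′ ¬′ C → B′ ∧′ Z′ ⊫ B ∧′ Z →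
                 Y ⊫ Y′ → Y ∨′ ¬′ Z ⊫ Y′ ∨′ ¬′ Z′ →
                 ((C , Z) ∷ G) ⊢C4 (B , Y) → ((C′ , Z′) ∷ G) ⊢C4 (B′ , Y′)
⊢-replace-pair body¬C bodyZ head headZ d =
  E4 ↭-refl (⊢-mono body¬C head (proj₁ (⊢-invert d)))
            (⊢-mono bodyZ headZ (proj₂ (⊢-invert d)))

⊢-cut : G ⊢C4 (C , Z) → ((C , Z) ∷ G′) ⊢C4 (B , Y) → (G ++ G′) ⊢C4 (B , Y)
⊢-cut {G} (IN ⊢C) d =
  ⊢-weaken-++ G (⊢-mono (∧-¬-unsatisfiable-⊫ ⊢C) ⊫-refl (proj₁ (⊢-invert d)))
⊢-cut {G} (OUT ⊢Z) d =
  ⊢-weaken-++ G (⊢-mono (∧-valid-⊫ ⊢Z) (∨-¬-valid-⊫ ⊢Z) (proj₂ (⊢-invert d)))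
⊢-cut {C = C} {Z = Z} {G′ = G′} {B = B} {Y = Y} (E4 {A = A} {X = X} σ d₁ d₂) d =
  E4 (++⁺ʳ G′ σ)
     (⊢-cut d₁ (⊢-replace-pair (∧-¬-cancelʳ-⊫ B (¬′ A) C) (∧-elimᵐ-⊫ B (¬′ A) Z)
                               ⊫-refl ⊫-refl d))
     (⊢-cut d₂ (⊢-replace-pair (∧-¬-cancelʳ-⊫ B X C) (disjunctive-syllogism-⊫ B X Z)
                               (∨-introˡ-⊫ Y (¬′ X)) (∨-¬-absorbʳ-⊫ Y Z X) d))

lemma11 : (∀ (G : List Pair) (A X B Y : Formula) →
              G ⊢C4 (B , Y) → ((A , X) ∷ G) ⊢C4 (B , Y))
          × (∀ (G : List Pair) (A X B Y : Formula) →
              ((A , X) ∷ (A , X) ∷ G) ⊢C4 (B , Y) → ((A , X) ∷ G) ⊢C4 (B , Y))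
          × (∀ (G G′ : List Pair) (C Z B Y : Formula) →
              G ⊢C4 (C , Z) → ((C , Z) ∷ G′) ⊢C4 (B , Y) → (G ++ G′) ⊢C4 (B , Y))
lemma11 = (λ _ _ _ _ _ → ⊢-weaken)
        , (λ _ _ _ _ _ → ⊢-contract)
        , (λ _ _ _ _ _ _ → ⊢-cut)
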